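{- Let $G$ be a group generated as a monoid by a subset $A\subseteq G$ closed under $G$-conjugation, and let $c\in G$ with $\mathrm{Red}_A(c)$ finite. If there exists a $c$-compatible order of $A_c$, then $\mathcal{P}_c(G,A)$ is locally Hurwitz-connected.
   Context: For $x\in G$, $\ell_A(x)$ is the least $k\ge 0$ such that $x$ is a product of $k$ elements of $A$; such a product with $k=\ell_A(x)$, written as a tuple, is a reduced $A$-factorization, and $\mathrm{Red}_A(x)$ is the set of these. $x\le_A y$ iff $\ell_A(x)+\ell_A(x^{ -1}y)=\ell_A(y)$. $\mathcal{P}_c(G,A)$ is $\{x: e\le_A x\le_A c\}$ ordered by $\le_A$, and $A_c=\{a\in A: a\le_A c\}$. A linear order $\prec$ on $A_c$ is $c$-compatible if every $g\le_A c$ with $\ell_A(g)=2$ has exactly one reduced $A$-factorization $(a,b)$ with $a\preceq b$. $\mathcal{P}_c$ is locally Hurwitz-connected if for every $g\le_A c$ with $\ell_A(g)=2$, the braid group $B_2=\langle\sigma_1\rangle$ acting by $\sigma_1\cdot(a_1,a_2)=(a_2,a_2^{ -1}a_1a_2)$ acts transitively on $\mathrm{Red}_A(g)$. -}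

module Defs where

open import Level using (Level; _⊔_)
open import Algebra.Bundles using (Group)
open import Data.Nat using (ℕ; zero; suc; _+_; _<_)
open import Data.Integer using (ℤ; +_; -[1+_])
open import Data.List using (List; []; _∷_; length; foldr)
open import Data.List.Relation.Unary.All using (All)
open import Data.List.Relation.Unary.Any using (Any)
open import Data.List.Relation.Binary.Pointwise using (Pointwise)
open import Data.Product using (Σ; ∃; _×_; _,_)
open import Relation.Binary.PropositionalEquality using (_≡_)
open import Relation.Nullary using (¬_)

module Setup {c ℓ a : Level} (G : Group c ℓ) (A : Group.Carrier G → Set a) where
  open Group G

  prod : List Carrier → Carrier
  prod = foldr _∙_ ε

  Fact : Carrier → ℕ → Set (c ⊔ ℓ ⊔ a)
  Fact x k = Σ (List Carrier) λ xs → length xs ≡ k × All A xs × prod xs ≈ x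

  HasLen : Carrier → ℕ → Set (c ⊔ ℓ ⊔ a)
  HasLen x k = Fact x k × (∀ j → j < k → ¬ Fact x j)

  Red : Carrier → List Carrier → Set (c ⊔ ℓ ⊔ a)
  Red x xs = All A xs × prod xs ≈ x × HasLen x (length xs)

  GeneratesAsMonoid : Set (c ⊔ ℓ ⊔ a)
  GeneratesAsMonoid = ∀ x → ∃ λ k → Fact x k

  ConjClosed : Set (c ⊔ a)
  ConjClosed = ∀ g x → A x → A (g ⁻¹ ∙ x ∙ g)

  RespectsEq : Set (c ⊔ ℓ ⊔ a)
  RespectsEq = ∀ {x y} → x ≈ y → A x → A y

  RedFinite : Carrier → Set (c ⊔ ℓ ⊔ a)
  RedFinite x = Σ (List (List Carrier)) λ L →
    ∀ xs → Red x xs → Any (Pointwise _≈_ xs) L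

  _≤A_ : Carrier → Carrier → Set (c ⊔ ℓ ⊔ a)
  x ≤A y = Σ ℕ λ i → Σ ℕ λ j → Σ ℕ λ k →
    HasLen x i × HasLen (x ⁻¹ ∙ y) j × HasLen y k × i + j ≡ k

  InAc : Carrier → Carrier → Set (c ⊔ ℓ ⊔ a)
  InAc cc x = A x × x ≤A cc

  IsLinearOrderOnAc : ∀ {o} → Carrier → (Carrier → Carrier → Set o) → Set (c ⊔ ℓ ⊔ a ⊔ o)
  IsLinearOrderOnAc cc _≼_ =
    (∀ {x y} → InAc cc x → InAc cc y → x ≈ y → x ≼ y) ×
    (∀ {x y} → InAc cc x → InAc cc y → x ≼ y → y ≼ x → x ≈ y) ×
    (∀ {x y z} → InAc cc x → InAc cc y → InAc cc z → x ≼ y → y ≼ z → x ≼ z) ×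
    (∀ {x y} → InAc cc x → InAc cc y → (x ≼ y) ⊎' (y ≼ x))
    where
    open import Data.Sum renaming (_⊎_ to _⊎'_)

  CCompatible : ∀ {o} → Carrier → (Carrier → Carrier → Set o) → Set (c ⊔ ℓ ⊔ a ⊔ o)
  CCompatible cc _≼_ = IsLinearOrderOnAc cc _≼_ ×
    (∀ g → g ≤A cc → HasLen g 2 →
      Σ Carrier λ x → Σ Carrier λ y →
        (Red g (x ∷ y ∷ []) × x ≼ y) ×
        (∀ x' y' → Red g (x' ∷ y' ∷ []) → x' ≼ y' → x' ≈ x × y' ≈ y))

  σ : Carrier × Carrier → Carrier × Carrier
  σ (x , y) = y , (y ⁻¹ ∙ x ∙ y)

  σ⁻ : Carrier × Carrier → Carrier × Carrier
  σ⁻ (x , y) = (x ∙ y ∙ x ⁻¹) , x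

  σ^ : ℕ → Carrier × Carrier → Carrier × Carrier
  σ^ zero p = p
  σ^ (suc n) p = σ (σ^ n p)

  σ⁻^ : ℕ → Carrier × Carrier → Carrier × Carrier
  σ⁻^ zero p = p
  σ⁻^ (suc n) p = σ⁻ (σ⁻^ n p)

  -- action of σ₁ⁿ ∈ B₂ ≅ ℤ
  act : ℤ → Carrier × Carrier → Carrier × Carrier
  act (+ n) p = σ^ n p
  act -[1+ n ] p = σ⁻^ (suc n) p

  _≈₂_ : Carrier × Carrier → Carrier × Carrier → Set ℓ
  (x , y) ≈₂ (x' , y') = x ≈ x' × y ≈ y'

  LocallyHurwitzConnected : Carrier → Set (c ⊔ ℓ ⊔ a)
  LocallyHurwitzConnected cc =
    ∀ g → g ≤A cc → HasLen g 2 →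
      ∀ x y x' y' → Red g (x ∷ y ∷ []) → Red g (x' ∷ y' ∷ []) →
        Σ ℤ λ n → act n (x , y) ≈₂ (x' , y')

module Submission where

-- Fix g ≤_A c with ℓ_A(g) = 2 and a reduced factorization (x , y) of g.
-- The Hurwitz orbit σⁿ(x , y) = (fₙ , fₙ₊₁) is encoded by the single
-- sequence f₀ = x, f₁ = y, fₙ₊₂ = fₙ₊₁⁻¹ fₙ fₙ₊₁ of letters; every pair
-- (fₙ , fₙ₊₁) is again a reduced factorization of g, hence extends to a
-- reduced factorization of c, so every fₙ lies in A_c.  Since Red_A(c) is
-- finite, the pigeonhole principle yields i < j with fᵢ = fⱼ.  A sequence
-- in a linearly ordered set that returns to an earlier value cannot descend
-- at every step, so some pair (fₖ , fₖ₊₁) satisfies fₖ ≼ fₖ₊₁; by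
-- c-compatibility it is THE sorted factorization (p , q) of g.  Thus both
-- orbits of two factorizations of g meet at (p , q), and inverting the
-- braid powers connects them by some σ₁ᶻ, z ∈ ℤ.

open import Defs
open import Level using (Level)
open import Algebra.Bundles using (Group)
open import Data.Product using (Σ; _×_; _,_; proj₁; proj₂)
open import Data.Sum using (_⊎_; inj₁; inj₂; [_,_]′)
open import Data.Nat using (ℕ; zero; suc; _+_; _∸_; _<_; s≤s)
import Data.Nat.Properties as ℕₚ
open import Data.Integer using (ℤ; +_; -[1+_])
open import Data.List using (List; []; _∷_; _++_; length; lookup)
import Data.List.Properties as Listₚ
open import Data.List.Relation.Unary.All using ([]; _∷_)
import Data.List.Relation.Unary.All.Properties as Allₚ
open import Data.List.Relation.Unary.Any using (Any; index)
open import Data.List.Relation.Unary.Any.Properties using (lookup-index)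
open import Data.List.Relation.Binary.Pointwise using (Pointwise; _∷_)
open import Data.Fin using (toℕ)
import Data.Fin.Properties as Finₚ
open import Data.Empty using (⊥-elim)
open import Relation.Binary.Definitions using (tri<; tri≈; tri>)
open import Function using (id; _∘_)
open import Relation.Binary.PropositionalEquality as ≡ using (_≡_)

repetition : ∀ {a b r} {X : Set a} {Y : Set b} {R : X → Y → Set r}
  (L : List Y) (u : ℕ → X) → (∀ n → Any (R (u n)) L) →
  Σ ℕ λ i → Σ ℕ λ j → i < j × Σ Y λ y → R (u i) y × R (u j) y
repetition {R = R} L u cover
  with Finₚ.pigeonhole (ℕₚ.n<1+n (length L)) (λ t → index (cover (toℕ t)))
... | i , j , i<j , sameIndex =
  toℕ i , toℕ j , i<j , lookup L (index (cover (toℕ j))) ,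
  ≡.subst (R (u (toℕ i)) ∘ lookup L) sameIndex (lookup-index (cover (toℕ i))) ,
  lookup-index (cover (toℕ j))

module Ascents {c ℓ o s} {C : Set c} (_≈_ : C → C → Set ℓ) (_≼_ : C → C → Set o)
  (S : C → Set s)
  (≼-reflexive : ∀ {x y} → S x → S y → x ≈ y → x ≼ y)
  (≼-trans : ∀ {x y z} → S x → S y → S z → x ≼ y → y ≼ z → x ≼ z)
  (≼-total : ∀ {x y} → S x → S y → (x ≼ y) ⊎ (y ≼ x))
  (f : ℕ → C) (f∈S : ∀ n → S (f n)) where

  Ascent : Set o
  Ascent = Σ ℕ λ k → f k ≼ f (suc k)

  -- Without an ascent, the sequence only goes down from any starting index
  -- (for d = 0, reflexivity on S follows from totality).
  descent : ∀ s d → Ascent ⊎ (f (d + s) ≼ f s)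
  descent s zero = inj₂ ([ id , id ]′ (≼-total (f∈S s) (f∈S s)))
  descent s (suc d) with descent s d
  ... | inj₁ ascent = inj₁ ascent
  ... | inj₂ below with ≼-total (f∈S (d + s)) (f∈S (suc (d + s)))
  ...   | inj₁ up = inj₁ (d + s , up)
  ...   | inj₂ down = inj₂ (≼-trans (f∈S _) (f∈S _) (f∈S s) down below)

  -- A sequence that returns to an earlier value has an ascent: otherwise
  -- f i ≈ f j ≼ f (i + 1) would already be one.
  ascent-of-return : ∀ {i j} → i < j → f i ≈ f j → Ascent
  ascent-of-return {i} {j} i<j fi≈fj with descent (suc i) (j ∸ suc i)
  ... | inj₁ ascent = ascent
  ... | inj₂ below = i , ≼-trans (f∈S i) (f∈S j) (f∈S (suc i))
          (≼-reflexive (f∈S i) (f∈S j) fi≈fj)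
          (≡.subst (λ t → f t ≼ f (suc i)) (ℕₚ.m∸n+n≡m i<j) below)

module Theory {c ℓ a} (G : Group c ℓ) (A : Group.Carrier G → Set a) where
  open Group G
  open Setup G A
  open import Algebra.Properties.Group G using (\\-leftDividesˡ; \\-leftDividesʳ)
  open import Relation.Binary.Reasoning.Setoid setoid

  hasLen-unique : ∀ {x i j} → HasLen x i → HasLen x j → i ≡ j
  hasLen-unique {i = i} {j} (fi , mi) (fj , mj) with ℕₚ.<-cmp i j
  ... | tri< i<j _ _ = ⊥-elim (mj i i<j fi)
  ... | tri≈ _ i≡j _ = i≡j
  ... | tri> _ _ j<i = ⊥-elim (mi j j<i fj)

  prod-++ : ∀ xs ys → prod (xs ++ ys) ≈ prod xs ∙ prod ys
  prod-++ [] ys = sym (identityˡ (prod ys))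
  prod-++ (x ∷ xs) ys = trans (∙-congˡ (prod-++ xs ys)) (sym (assoc x (prod xs) (prod ys)))

  -- If g ≤_A c, a reduced factorization of g⁻¹c extends every reduced
  -- factorization of g to one of c.
  ≤A-extension : ∀ {g cc} → g ≤A cc →
    Σ (List Carrier) λ fs → ∀ {xs} → Red g xs → Red cc (xs ++ fs)
  ≤A-extension {g} {cc} (i , j , k , ℓg , ((fs , len , Afs , prod≈) , _) , ℓcc , i+j≡k) =
    fs , extended
    where
    extended : ∀ {xs} → Red g xs → Red cc (xs ++ fs)
    extended {xs} (Axs , prodxs≈g , ℓg′) =
      Allₚ.++⁺ Axs Afs , product , ≡.subst (HasLen cc) lengths ℓcc
      where
      product : prod (xs ++ fs) ≈ cc
      product = begin
        prod (xs ++ fs)        ≈⟨ prod-++ xs fs ⟩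
        prod xs ∙ prod fs      ≈⟨ ∙-cong prodxs≈g prod≈ ⟩
        g ∙ (g ⁻¹ ∙ cc)        ≈⟨ \\-leftDividesˡ g cc ⟩
        cc                     ∎
      lengths : k ≡ length (xs ++ fs)
      lengths = ≡.trans (≡.sym i+j≡k) (≡.trans
        (≡.cong₂ _+_ (hasLen-unique ℓg ℓg′) (≡.sym len)) (≡.sym (Listₚ.length-++ xs)))

  -- The first letter x of a reduced factorization of c satisfies x ≤_A c:
  -- it has length 1, and the remaining letters are a reduced factorization
  -- of x⁻¹c (anything shorter would shorten the factorization of c).
  head-≤A : ∀ {cc x xs} → Red cc (x ∷ xs) → x ≤A cc
  head-≤A {cc} {x} {xs} (Ax ∷ Axs , prod≈cc , ℓcc@(_ , minimal)) =
    1 , length xs , suc (length xs) , letter , rest , ℓcc , ≡.refl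
    where
    letter : HasLen x 1
    letter = (x ∷ [] , ≡.refl , Ax ∷ [] , identityʳ x) , λ where
      zero _ ([] , ≡.refl , _ , ε≈x) → minimal (length xs) (ℕₚ.n<1+n _)
        (xs , ≡.refl , Axs , (begin
          prod xs      ≈⟨ sym (identityˡ (prod xs)) ⟩
          ε ∙ prod xs  ≈⟨ ∙-congʳ ε≈x ⟩
          x ∙ prod xs  ≈⟨ prod≈cc ⟩
          cc           ∎))
      (suc _) (s≤s ()) _
    quotient : prod xs ≈ x ⁻¹ ∙ cc
    quotient = sym (trans (∙-congˡ (sym prod≈cc)) (\\-leftDividesʳ x (prod xs)))
    rest : HasLen (x ⁻¹ ∙ cc) (length xs)
    rest = (xs , ≡.refl , Axs , quotient) , λ where
      j j<n (hs , len , Ahs , prodhs≈) → minimal (suc j) (s≤s j<n)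
        (x ∷ hs , ≡.cong suc len , Ax ∷ Ahs ,
          trans (∙-congˡ prodhs≈) (\\-leftDividesˡ x cc))

  word : Carrier × Carrier → List Carrier
  word (x , y) = x ∷ y ∷ []

  first-letter-InAc : ∀ {g cc x y} → g ≤A cc → Red g (word (x , y)) → InAc cc x
  first-letter-InAc g≤c red@(Ax ∷ _ , _) =
    Ax , head-≤A (proj₂ (≤A-extension g≤c) red)

  σ-Red : ConjClosed → ∀ {g u} → Red g (word u) → Red g (word (σ u))
  σ-Red conj {g} {x , y} (Ax ∷ Ay ∷ _ , prod≈g , ℓg) =
    Ay ∷ conj y x Ax ∷ [] , product , ℓg
    where
    product : y ∙ ((y ⁻¹ ∙ x ∙ y) ∙ ε) ≈ g
    product = begin
      y ∙ ((y ⁻¹ ∙ x ∙ y) ∙ ε)  ≈⟨ ∙-congˡ (identityʳ _) ⟩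
      y ∙ (y ⁻¹ ∙ x ∙ y)        ≈⟨ sym (assoc y (y ⁻¹ ∙ x) y) ⟩
      y ∙ (y ⁻¹ ∙ x) ∙ y        ≈⟨ ∙-congʳ (\\-leftDividesˡ y x) ⟩
      x ∙ y                     ≈⟨ ∙-congˡ (sym (identityʳ y)) ⟩
      x ∙ (y ∙ ε)               ≈⟨ prod≈g ⟩
      g                         ∎

  ≈₂-sym : ∀ {u v} → u ≈₂ v → v ≈₂ u
  ≈₂-sym (p , q) = sym p , sym q

  ≈₂-trans : ∀ {u v w} → u ≈₂ v → v ≈₂ w → u ≈₂ w
  ≈₂-trans (p , q) (p′ , q′) = trans p p′ , trans q q′

  σ⁻-cong : ∀ {u v} → u ≈₂ v → σ⁻ u ≈₂ σ⁻ v
  σ⁻-cong (p , q) = ∙-cong (∙-cong p q) (⁻¹-cong p) , p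

  σ⁻^-cong : ∀ m {u v} → u ≈₂ v → σ⁻^ m u ≈₂ σ⁻^ m v
  σ⁻^-cong zero u≈v = u≈v
  σ⁻^-cong (suc m) u≈v = σ⁻-cong (σ⁻^-cong m u≈v)

  σ⁻-σ : ∀ u → σ⁻ (σ u) ≈₂ u
  σ⁻-σ (x , y) = conjugate-back , refl
    where
    conjugate-back : y ∙ (y ⁻¹ ∙ x ∙ y) ∙ y ⁻¹ ≈ x
    conjugate-back = begin
      y ∙ (y ⁻¹ ∙ x ∙ y) ∙ y ⁻¹    ≈⟨ ∙-congʳ (sym (assoc y (y ⁻¹ ∙ x) y)) ⟩
      y ∙ (y ⁻¹ ∙ x) ∙ y ∙ y ⁻¹    ≈⟨ assoc _ y (y ⁻¹) ⟩
      y ∙ (y ⁻¹ ∙ x) ∙ (y ∙ y ⁻¹)  ≈⟨ ∙-cong (\\-leftDividesˡ y x) (inverseʳ y) ⟩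
      x ∙ ε                        ≈⟨ identityʳ x ⟩
      x                            ∎

  σ⁻^-suc : ∀ m u → σ⁻^ (suc m) u ≡ σ⁻^ m (σ⁻ u)
  σ⁻^-suc zero u = ≡.refl
  σ⁻^-suc (suc m) u = ≡.cong σ⁻ (σ⁻^-suc m u)

  σ^-undo : ∀ m {u w} → σ^ m u ≈₂ w → u ≈₂ σ⁻^ m w
  σ^-undo zero u≈w = u≈w
  σ^-undo (suc m) {u} {w} σu≈w =
    ≡.subst (u ≈₂_) (≡.sym (σ⁻^-suc m w))
      (σ^-undo m (≈₂-trans (≈₂-sym (σ⁻-σ _)) (σ⁻-cong σu≈w)))

  diff : ℕ → ℕ → ℤ
  diff n zero = + n
  diff zero (suc m) = -[1+ m ]
  diff (suc n) (suc m) = diff n m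

  act-diff : ∀ n m u → σ⁻^ m (σ^ n u) ≈₂ act (diff n m) u
  act-diff n zero u = refl , refl
  act-diff zero (suc m) u = refl , refl
  act-diff (suc n) (suc m) u =
    ≡.subst (_≈₂ act (diff n m) u) (≡.sym (σ⁻^-suc m (σ (σ^ n u))))
      (≈₂-trans (σ⁻^-cong m (σ⁻-σ _)) (act-diff n m u))

  orbits-meet : ∀ {u v w} → (Σ ℕ λ n → σ^ n u ≈₂ w) → (Σ ℕ λ m → σ^ m v ≈₂ w) →
    Σ ℤ λ z → act z u ≈₂ v
  orbits-meet {u} (n , σⁿu≈w) (m , σᵐv≈w) =
    diff n m , ≈₂-sym (≈₂-trans (σ^-undo m σᵐv≈w)
      (≈₂-trans (σ⁻^-cong m (≈₂-sym σⁿu≈w)) (act-diff n m u)))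

  module Orbit (conj : ConjClosed) {cc : Carrier} (finite : RedFinite cc)
    {g : Carrier} (g≤c : g ≤A cc) {o} (_≼_ : Carrier → Carrier → Set o)
    (linear : IsLinearOrderOnAc cc _≼_)
    (u : Carrier × Carrier) (red : Red g (word u)) where

    -- σⁿ u = (letter n , letter (suc n)).
    letter : ℕ → Carrier
    letter n = proj₁ (σ^ n u)

    orbit-Red : ∀ n → Red g (word (σ^ n u))
    orbit-Red zero = red
    orbit-Red (suc n) = σ-Red conj (orbit-Red n)

    letter-InAc : ∀ n → InAc cc (letter n)
    letter-InAc n = first-letter-InAc g≤c (orbit-Red n)

    -- Each σⁿ u extends to a reduced factorization of c; as Red_A(c) is
    -- finite, two of these coincide, so some letter recurs.
    letters-repeat : Σ ℕ λ i → Σ ℕ λ j → i < j × letter i ≈ letter j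
    letters-repeat
      with repetition {R = Pointwise _≈_} (proj₁ finite)
             (λ n → word (σ^ n u) ++ proj₁ (≤A-extension g≤c))
             (λ n → proj₂ finite _ (proj₂ (≤A-extension g≤c) (orbit-Red n)))
    ... | i , j , i<j , _ , p ∷ _ , q ∷ _ = i , j , i<j , trans p (sym q)

    open Ascents _≈_ _≼_ (InAc cc)
      (proj₁ linear) (proj₁ (proj₂ (proj₂ linear))) (proj₂ (proj₂ (proj₂ linear)))
      letter letter-InAc

    ascent : Ascent
    ascent = let i , j , i<j , same = letters-repeat in ascent-of-return i<j same

lemma5p6 : ∀ {c ℓ a o : Level} (G : Group c ℓ) (A : Group.Carrier G → Set a) →
    Setup.RespectsEq G A →
    Setup.GeneratesAsMonoid G A →
    Setup.ConjClosed G A →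
    (cc : Group.Carrier G) →
    Setup.RedFinite G A cc →
    Σ (Group.Carrier G → Group.Carrier G → Set o) (λ _≼_ → Setup.CCompatible G A cc _≼_) →
    Setup.LocallyHurwitzConnected G A cc
lemma5p6 G A _ _ conj cc finite (_≼_ , linear , sorted) g g≤c ℓg=2 x y x′ y′ red red′
  with sorted g g≤c ℓg=2
... | p , q , _ , sorted-unique =
  orbits-meet (reaches-sorted (x , y) red) (reaches-sorted (x′ , y′) red′)
  where
  open Setup G A
  open Theory G A

  -- Every Hurwitz orbit of a reduced factorization of g passes through the
  -- sorted one, (p , q): the pair at an ascent of the orbit is sorted.
  reaches-sorted : ∀ u → Red g (word u) → Σ ℕ λ n → σ^ n u ≈₂ (p , q)
  reaches-sorted u red-u =
    let open Orbit conj finite g≤c _≼_ linear u red-u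
        k , sortedₖ = ascent
    in k , sorted-unique _ _ (orbit-Red k) sortedₖ
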